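{- There does not exist a function $g:\mathbb{N}\to\mathbb{N}$ such that, for every digraph $D$, $\operatorname{bcrk}(D)\leq g(\operatorname{dbw}(D))$.
   Context: All digraphs are finite; $\vec{xy}$ denotes the directed edge from $x$ to $y$. Layouts: for a finite set $U$ and a symmetric function $f:2^U\to\mathbb{Z}$ (i.e. $f(X)=f(U\setminus X)$), a layout of $f$ on $U$ is a pair $(T,\beta)$ with $T$ a tree of maximum degree at most three and $\beta$ a bijection from the leaves of $T$ to $U$. For an edge $xy$ of $T$, with $Y$ the set of leaves in the component of $T-xy$ containing $y$, its order is $f(\beta(Y))$. The width of the layout is the maximum order of an edge, and the layout-$f$-width of $U$ is the minimum width of a layout of $f$ on $U$. Directed branch-width: for $B\subseteq E(D)$ let $S_B^V=\{y\in V(D): \exists x,z \text{ with } \vec{xy}\in E(D)\setminus B,\ \vec{yz}\in B\}$. With $f_D(X)=|S_X^V\cup S_{E(D)\setminus X}^V|$, $\operatorname{dbw}(D)$ is the layout-$f_D$-width of $E(D)$. Bi-cut-rank-width: let $M$ be the adjacency matrix of $D$ over $\mathbb{GF}(2)$, with entry $(u,v)$ equal to $1$ iff $\vec{uv}\in E(D)$. Let $g(X)=\operatorname{rk}(M[V(D)\setminus X,X])+\operatorname{rk}(M[X,V(D)\setminus X])$, where $M[A,B]$ is the submatrix with rows indexed by $A$ and columns by $B$. Then $\operatorname{bcrk}(D)$ is the layout-$g$-width of $V(D)$. -}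

module Defs where

open import Data.Nat using (ℕ; zero; suc; _+_; _*_; _≤_; _⊔_)
open import Data.Bool using (Bool; true; false; _∧_; _∨_; not; _xor_; if_then_else_)
open import Data.Fin using (Fin; zero; suc)
open import Data.Fin.Properties using (_≟_)
open import Data.Fin.Subset using (Subset; ∁; ∣_∣)
open import Data.Vec using (Vec; []; _∷_; lookup; tabulate)
open import Data.List using (List; []; _∷_; _++_; map; foldr; length)
open import Data.Sum using (_⊎_)
open import Data.Product using (Σ; _×_; _,_; proj₁; proj₂)
open import Function.Definitions using (Injective)
open import Function.Bundles using (_⤖_; Bijection)
open import Relation.Nullary using (¬_; does)
open import Relation.Binary.PropositionalEquality using (_≡_; _≢_)
open import Relation.Binary.Construct.Closure.ReflexiveTransitive using (Star)

anyF : ∀ {m} → (Fin m → Bool) → Bool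
anyF {zero} f = false
anyF {suc m} f = f zero ∨ anyF (λ i → f (suc i))

allF : ∀ {m} → (Fin m → Bool) → Bool
allF {zero} f = true
allF {suc m} f = f zero ∧ allF (λ i → f (suc i))

countF : ∀ {m} → (Fin m → Bool) → ℕ
countF {zero} f = 0
countF {suc m} f = (if f zero then 1 else 0) + countF (λ i → f (suc i))

parityF : ∀ {m} → (Fin m → Bool) → Bool
parityF {zero} f = false
parityF {suc m} f = f zero xor parityF (λ i → f (suc i))

_=F_ : ∀ {n} → Fin n → Fin n → Bool
x =F y = does (x ≟ y)

allSubsets : (n : ℕ) → List (Subset n)
allSubsets zero = [] ∷ []
allSubsets (suc n) = map (false ∷_) (allSubsets n) ++ map (true ∷_) (allSubsets n)

allL : ∀ {A : Set} → (A → Bool) → List A → Bool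
allL p [] = true
allL p (x ∷ xs) = p x ∧ allL p xs

maxList : List ℕ → ℕ
maxList = foldr _⊔_ 0

module GraphNotions {k : ℕ} (adj : Fin k → Fin k → Bool) where

  Adj : Fin k → Fin k → Set
  Adj x y = adj x y ≡ true

  degree : Fin k → ℕ
  degree v = countF (adj v)

  data Linked : List (Fin k) → Set where
    [-]  : ∀ {x} → Linked (x ∷ [])
    _∷ₗ_ : ∀ {x y xs} → Adj x y → Linked (y ∷ xs) → Linked (x ∷ y ∷ xs)

  data Distinct : List (Fin k) → Set where
    []ᵈ  : Distinct []
    _∷ᵈ_ : ∀ {x xs} → allL (λ y → not (x =F y)) xs ≡ true → Distinct xs → Distinct (x ∷ xs)

  HasCycle : Set
  HasCycle = Σ (Fin k) λ v → Σ (List (Fin k)) λ ws →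
               (2 ≤ length ws) × Distinct (v ∷ ws) × Linked (v ∷ ws ++ v ∷ [])

  IsLeaf : Fin k → Set
  IsLeaf v = degree v ≤ 1

  Leaf : Set
  Leaf = Σ (Fin k) IsLeaf

  AdjWithout : Fin k → Fin k → Fin k → Fin k → Set
  AdjWithout x y u v = Adj u v × ¬ ((u ≡ x × v ≡ y) ⊎ (u ≡ y × v ≡ x))

record SubcubicTree : Set where
  field
    k       : ℕ
    adj     : Fin k → Fin k → Bool
    adj-sym : ∀ x y → adj x y ≡ adj y x
    irrefl  : ∀ x → adj x x ≡ false
  open GraphNotions adj public
  field
    nonempty  : 1 ≤ k
    connected : ∀ x y → Star Adj x y
    acyclic   : ¬ HasCycle
    maxdeg≤3  : ∀ v → degree v ≤ 3

record Layout (m : ℕ) : Set where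
  field
    tree : SubcubicTree
  open SubcubicTree tree public
  field
    β : Leaf ⤖ Fin m

  β⟨_⟩ : Leaf → Fin m
  β⟨ ℓ ⟩ = Bijection.to β ℓ

  -- Y = β(leaves in the component of T - xy containing y)
  IsSide : Fin k → Fin k → Subset m → Set
  IsSide x y Y = ∀ (ℓ : Leaf) →
    (lookup Y β⟨ ℓ ⟩ ≡ true → Star (AdjWithout x y) y (proj₁ ℓ)) ×
    (Star (AdjWithout x y) y (proj₁ ℓ) → lookup Y β⟨ ℓ ⟩ ≡ true)

WidthAtMost : ∀ {m} → (Subset m → ℕ) → Layout m → ℕ → Set
WidthAtMost f L w = ∀ x y → Adj x y → ∀ Y → IsSide x y Y → f Y ≤ w
  where open Layout L

IsLayoutWidth : ∀ {m} → (Subset m → ℕ) → ℕ → Set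
IsLayoutWidth {m} f w =
  Σ (Layout m) (λ L → WidthAtMost f L w) ×
  (∀ (L : Layout m) (j : ℕ) → WidthAtMost f L j → w ≤ j)

record Digraph : Set where
  field
    n        : ℕ
    m        : ℕ
    edge     : Fin m → Fin n × Fin n          -- edge i = (x , y) means i is xy⃗
    edge-inj : Injective _≡_ _≡_ edge
    loopless : ∀ i → proj₁ (edge i) ≢ proj₂ (edge i)

  tail head : Fin m → Fin n
  tail i = proj₁ (edge i)
  head i = proj₂ (edge i)

  -- y ∈ S^V_B : some edge xy⃗ ∉ B and some edge yz⃗ ∈ B
  inS : Subset m → Fin n → Bool
  inS B y = anyF (λ i → not (lookup B i) ∧ (head i =F y))
          ∧ anyF (λ j → lookup B j ∧ (tail j =F y))

  fD : Subset m → ℕ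
  fD X = ∣ tabulate (λ y → inS X y ∨ inS (∁ X) y) ∣

  M : Fin n → Fin n → Bool
  M u v = anyF (λ i → (tail i =F u) ∧ (head i =F v))

  -- GF(2)-rank of M[R, C]: maximum number of linearly independent rows
  _⊆ᵇ_ : Subset n → Subset n → Bool
  T ⊆ᵇ S = allF (λ u → not (lookup T u) ∨ lookup S u)

  -- the rows of S (restricted to the columns C) are linearly independent:
  -- no nonempty subset T of them sums to zero over GF(2)
  independent : Subset n → Subset n → Bool
  independent C S = allL (λ T → not ((T ⊆ᵇ S) ∧ anyF (lookup T))
                           ∨ anyF (λ c → lookup C c ∧ parityF (λ u → lookup T u ∧ M u c)))
                        (allSubsets n)

  rk : Subset n → Subset n → ℕ
  rk R C = maxList (map (λ S → if (S ⊆ᵇ R) ∧ independent C S then ∣ S ∣ else 0)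
                        (allSubsets n))

  gD : Subset n → ℕ
  gD X = rk (∁ X) X + rk X (∁ X)

IsDbw : Digraph → ℕ → Set
IsDbw D w = IsLayoutWidth (Digraph.fD D) w

IsBcrk : Digraph → ℕ → Set
IsBcrk D w = IsLayoutWidth (Digraph.gD D) w

module Submission where

-- Orient the 1-subdivision of K_{n,n} towards its n² subdivision vertices. No vertex is both
-- the head and the tail of an edge, so f_D vanishes and dbw = 0. Now take n = 3(s + 1). A
-- balanced-separator argument on the subcubic tree gives every layout of V(D) an edge whose
-- side Y and its complement each contain more than s of the left vertices. Pairing left
-- vertices in Y with right vertices outside Y (or the reverse, for the complement of Y) and
-- taking the subdivision vertex of each pair gives an induced matching of size s + 1 across
-- the cut, so g(Y) > s and bcrk > s. With s = g(0) the bound bcrk ≤ g(dbw) fails.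

open import Defs
open import Data.Nat using (ℕ; zero; suc; _+_; _*_; _≤_; _<_; _⊓_; z≤n; s≤s; _≤?_; _<?_)
open import Data.Nat.Properties renaming (_≟_ to _≟ℕ_)
open import Data.Bool using (Bool; true; false; _∧_; _∨_; not; if_then_else_)
open import Data.Bool.Properties
  using (∧-conicalˡ; ∧-conicalʳ; ∧-zeroʳ; ∧-identityʳ; ∨-comm; ¬-not; not-involutive; xor-identityʳ)
  renaming (_≟_ to _≟ᵇ_)
open import Data.Fin using (Fin; zero; suc; toℕ; fromℕ<; reduce≥; _↑ˡ_; _↑ʳ_; splitAt; join; remQuot; combine)
open import Data.Fin.Properties
  using ( _≟_; toℕ-injective; toℕ-fromℕ<; toℕ<n; toℕ-↑ʳ; splitAt-≥; splitAt-↑ˡ; splitAt-↑ʳ; join-splitAt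
        ; ↑ˡ-injective; ↑ʳ-injective; remQuot-combine)
import Data.Fin.Properties as Finₚ
open import Data.Fin.Subset using (Subset; ∁; ∣_∣)
open import Data.Vec using ([]; _∷_; lookup; tabulate)
open import Data.Vec.Properties using (lookup∘tabulate; lookup-map; map-∘; map-cong; map-id)
open import Data.List using (List; []; _∷_; _++_; map; length; zip; filter)
open import Data.List.Properties using (length-map; length-zipWith)
open import Data.Nat.ListAction using (sum)
open import Data.Bool.ListAction using (any)
open import Data.List.Membership.Propositional using (_∈_; _∉_; find; lose)
open import Data.List.Membership.Propositional.Properties using (∈-map⁺; ∈-map⁻; ∈-++⁺ˡ; ∈-++⁺ʳ; ∈-∃++; ∈-filter⁻)
open import Data.List.Relation.Unary.Any using (here; there; any?)
open import Data.List.Relation.Unary.All as All using (All; []; _∷_)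
import Data.List.Relation.Unary.All.Properties as Allₚ
open Allₚ using (¬Any⇒All¬)
open import Data.List.Relation.Unary.AllPairs as AllPairs using (AllPairs; []; _∷_)
open import Data.List.Relation.Unary.Unique.Propositional using (Unique)
import Data.List.Relation.Unary.AllPairs.Properties as AllPairsₚ
import Data.List.Relation.Unary.Unique.Propositional.Properties as Uniqueₚ
open import Data.Sum using (_⊎_; inj₁; inj₂; [_,_]′)
open import Data.Sum.Properties using (inj₂-injective)
open import Data.Product using (Σ; _×_; _,_; proj₁; proj₂)
open import Data.Empty using (⊥; ⊥-elim)
open import Data.Unit using (⊤; tt)
open import Relation.Nullary using (¬_; does; Dec; yes; no)
open import Relation.Nullary.Negation using (¬¬-map)
open import Relation.Nullary.Decidable using (_×-dec_; _⊎-dec_; dec-true; dec-false; ¬¬-excluded-middle)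
open import Relation.Unary using (Decidable)
open import Relation.Unary.Properties using (∁?)
open import Relation.Binary.PropositionalEquality
open import Function using (_∘_; id; flip)
open import Data.Nat.Induction using (<-rec)
open import Data.Nat.Tactic.RingSolver using (solve-∀)
open import Function.Bundles using (Bijection; mk⤖)
open import Relation.Binary.Construct.Closure.ReflexiveTransitive
  using (Star; ε; _◅_; _◅◅_; reverse) renaming (map to map⋆)

dec-sound : ∀ {P : Set} (P? : Dec P) → does P? ≡ true → P
dec-sound (yes p) _ = p

=F-refl : ∀ {n} (x : Fin n) → (x =F x) ≡ true
=F-refl x = dec-true (x ≟ x) refl

=F⇒≡ : ∀ {n} {x y : Fin n} → (x =F y) ≡ true → x ≡ y
=F⇒≡ {x = x} {y} = dec-sound (x ≟ y)

≢⇒=F-false : ∀ {n} {x y : Fin n} → x ≢ y → (x =F y) ≡ false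
≢⇒=F-false {x = x} {y} = dec-false (x ≟ y)

not-=F⇒≢ : ∀ {n} {x y : Fin n} → not (x =F y) ≡ true → x ≢ y
not-=F⇒≢ {x = x} x≠y refl rewrite =F-refl x with x≠y
... | ()

∧-intro : ∀ {a b} → a ≡ true → b ≡ true → a ∧ b ≡ true
∧-intro refl refl = refl

∨-elim : ∀ {a b} → a ∨ b ≡ true → a ≡ true ⊎ b ≡ true
∨-elim {true} _ = inj₁ refl
∨-elim {false} b = inj₂ b

∨-introˡ : ∀ {a b} → a ≡ true → a ∨ b ≡ true
∨-introˡ refl = refl

∨-introʳ : ∀ {a b} → b ≡ true → a ∨ b ≡ true
∨-introʳ {true} _ = refl
∨-introʳ {false} b = b

indicator : Bool → ℕ
indicator b = if b then 1 else 0

countF-cong : ∀ {m} {f g : Fin m → Bool} → (∀ i → f i ≡ g i) → countF f ≡ countF g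
countF-cong {zero} f≗g = refl
countF-cong {suc m} {f} {g} f≗g =
  cong₂ (λ b c → indicator b + c) (f≗g zero) (countF-cong (f≗g ∘ suc))

countF-mono : ∀ {m} {f g : Fin m → Bool} → (∀ i → f i ≡ true → g i ≡ true) → countF f ≤ countF g
countF-mono {zero} f⊆g = z≤n
countF-mono {suc m} {f} {g} f⊆g with f zero in f0 | g zero in g0
... | true | true = s≤s (countF-mono (f⊆g ∘ suc))
... | true | false with () ← trans (sym (f⊆g zero f0)) g0
... | false | true = m≤n⇒m≤1+n (countF-mono (f⊆g ∘ suc))
... | false | false = countF-mono (f⊆g ∘ suc)

countF-mono-< : ∀ {m} {f g : Fin m → Bool} a → (∀ i → f i ≡ true → g i ≡ true) →
                g a ≡ true → f a ≡ false → countF f < countF g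
countF-mono-< {suc m} {f} {g} zero f⊆g ga fa rewrite ga | fa = s≤s (countF-mono (f⊆g ∘ suc))
countF-mono-< {suc m} {f} {g} (suc a) f⊆g ga fa with f zero in f0 | g zero in g0
... | true | true = s≤s (countF-mono-< a (f⊆g ∘ suc) ga fa)
... | true | false with () ← trans (sym (f⊆g zero f0)) g0
... | false | true = m≤n⇒m≤1+n (countF-mono-< a (f⊆g ∘ suc) ga fa)
... | false | false = countF-mono-< a (f⊆g ∘ suc) ga fa

countF-∨ : ∀ {m} (f g : Fin m → Bool) → countF (λ i → f i ∨ g i) ≤ countF f + countF g
countF-∨ {zero} f g = z≤n
countF-∨ {suc m} f g with f zero | g zero
... | true | true = s≤s (≤-trans (countF-∨ (f ∘ suc) (g ∘ suc)) (+-monoʳ-≤ (countF (f ∘ suc)) (n≤1+n _)))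
... | true | false = s≤s (countF-∨ (f ∘ suc) (g ∘ suc))
... | false | true = ≤-trans (s≤s (countF-∨ (f ∘ suc) (g ∘ suc))) (≤-reflexive (sym (+-suc _ _)))
... | false | false = countF-∨ (f ∘ suc) (g ∘ suc)

countF-split : ∀ {m} (f g : Fin m → Bool) →
               countF f ≡ countF (λ i → f i ∧ g i) + countF (λ i → f i ∧ not (g i))
countF-split {zero} f g = refl
countF-split {suc m} f g with f zero | g zero
... | true | true = cong suc (countF-split (f ∘ suc) (g ∘ suc))
... | true | false = trans (cong suc (countF-split (f ∘ suc) (g ∘ suc))) (sym (+-suc _ _))
... | false | true = countF-split (f ∘ suc) (g ∘ suc)
... | false | false = countF-split (f ∘ suc) (g ∘ suc)

countF-false : ∀ {m} {f : Fin m → Bool} → (∀ i → f i ≡ false) → countF f ≡ 0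
countF-false {zero} f≡false = refl
countF-false {suc m} {f} f≡false rewrite f≡false zero = countF-false (f≡false ∘ suc)

countF-true : ∀ m → countF {m} (λ _ → true) ≡ m
countF-true zero = refl
countF-true (suc m) = cong suc (countF-true m)

countF-+-not : ∀ {m} (f : Fin m → Bool) → countF f + countF (λ i → not (f i)) ≡ m
countF-+-not {m} f = trans (sym (countF-split (λ _ → true) f)) (countF-true m)

countF-witness : ∀ {m} {f : Fin m → Bool} a → f a ≡ true → 1 ≤ countF f
countF-witness {suc m} zero fa rewrite fa = s≤s z≤n
countF-witness {suc m} {f} (suc a) fa = ≤-trans (countF-witness a fa) (m≤n+m _ (indicator (f zero)))

countF-two : ∀ {m} {f : Fin m → Bool} a b → f a ≡ true → f b ≡ true → a ≢ b → 2 ≤ countF f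
countF-two {f = f} a b fa fb a≢b rewrite countF-split f (_=F a) =
  +-mono-≤ (countF-witness a (∧-intro fa (=F-refl a)))
           (countF-witness b (∧-intro fb (cong not (≢⇒=F-false (a≢b ∘ sym)))))

countF-≤1 : ∀ {m} {f : Fin m → Bool} → (∀ i j → f i ≡ true → f j ≡ true → i ≡ j) → countF f ≤ 1
countF-≤1 {zero} f-unique = z≤n
countF-≤1 {suc m} {f} f-unique with f zero in f0
... | true = ≤-reflexive (cong suc (countF-false (λ i → ¬-not (Finₚ.0≢1+n ∘ f-unique zero (suc i) f0))))
... | false = countF-≤1 (λ i j fi fj → Finₚ.suc-injective (f-unique (suc i) (suc j) fi fj))

∣tabulate∣≡countF : ∀ {n} (f : Fin n → Bool) → ∣ tabulate f ∣ ≡ countF f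
∣tabulate∣≡countF {zero} f = refl
∣tabulate∣≡countF {suc n} f with f zero
... | true = cong suc (∣tabulate∣≡countF (f ∘ suc))
... | false = ∣tabulate∣≡countF (f ∘ suc)

lookup-∁ : ∀ {n} (Y : Subset n) u → lookup (∁ Y) u ≡ not (lookup Y u)
lookup-∁ Y u = lookup-map u not Y

∁-involutive : ∀ {n} (Y : Subset n) → ∁ (∁ Y) ≡ Y
∁-involutive Y = trans (sym (map-∘ not not Y)) (trans (map-cong not-involutive Y) (map-id Y))

support : ∀ {m} → (Fin m → Bool) → List (Fin m)
support {zero} f = []
support {suc m} f = if f zero then zero ∷ map suc (support (f ∘ suc)) else map suc (support (f ∘ suc))

length-support : ∀ {m} (f : Fin m → Bool) → length (support f) ≡ countF f
length-support {zero} f = refl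
length-support {suc m} f with f zero
... | true = cong suc (trans (length-map suc (support (f ∘ suc))) (length-support (f ∘ suc)))
... | false = trans (length-map suc (support (f ∘ suc))) (length-support (f ∘ suc))

∈-support⁺ : ∀ {m} {f : Fin m → Bool} a → f a ≡ true → a ∈ support f
∈-support⁺ {suc m} zero fa rewrite fa = here refl
∈-support⁺ {suc m} {f} (suc a) fa with f zero
... | true = there (∈-map⁺ suc (∈-support⁺ a fa))
... | false = ∈-map⁺ suc (∈-support⁺ a fa)

∈-support⁻ : ∀ {m} (f : Fin m → Bool) {a} → a ∈ support f → f a ≡ true
∈-support⁻ {suc m} f a∈ with f zero in f0
∈-support⁻ {suc m} f (here refl) | true = f0
∈-support⁻ {suc m} f (there a∈) | true with ∈-map⁻ suc a∈
... | b , b∈ , refl = ∈-support⁻ (f ∘ suc) b∈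
∈-support⁻ {suc m} f a∈ | false with ∈-map⁻ suc a∈
... | b , b∈ , refl = ∈-support⁻ (f ∘ suc) b∈

support-unique : ∀ {m} (f : Fin m → Bool) → Unique (support f)
support-unique {zero} f = []
support-unique {suc m} f with f zero
... | true = All.tabulate zero∉ ∷ Uniqueₚ.map⁺ Finₚ.suc-injective (support-unique (f ∘ suc))
  where zero∉ : ∀ {z} → z ∈ map suc (support (f ∘ suc)) → zero ≢ z
        zero∉ z∈ with ∈-map⁻ suc z∈
        ... | _ , _ , refl = λ ()
... | false = Uniqueₚ.map⁺ Finₚ.suc-injective (support-unique (f ∘ suc))

any-intro : ∀ {A : Set} {p : A → Bool} {z zs} → z ∈ zs → p z ≡ true → any p zs ≡ true
any-intro (here refl) pz = ∨-introˡ pz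
any-intro (there z∈) pz = ∨-introʳ (any-intro z∈ pz)

countF-any≤sum : ∀ {A : Set} {m} (h : A → Fin m → Bool) zs →
                 countF (λ i → any (λ z → h z i) zs) ≤ sum (map (countF ∘ h) zs)
countF-any≤sum {m = m} h [] = ≤-reflexive (countF-false {m} (λ _ → refl))
countF-any≤sum h (z ∷ zs) =
  ≤-trans (countF-∨ (h z) (λ i → any (λ z → h z i) zs)) (+-monoʳ-≤ (countF (h z)) (countF-any≤sum h zs))

sum-map-≤ : ∀ {A : Set} (h : A → ℕ) {c} zs → (∀ {z} → z ∈ zs → h z ≤ c) → sum (map h zs) ≤ length zs * c
sum-map-≤ h [] bound = z≤n
sum-map-≤ h (z ∷ zs) bound = +-mono-≤ (bound (here refl)) (sum-map-≤ h zs (bound ∘ there))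

∈-zip⁻ : ∀ {A B : Set} {xs : List A} {ys : List B} {π} → π ∈ zip xs ys → proj₁ π ∈ xs × proj₂ π ∈ ys
∈-zip⁻ {xs = x ∷ xs} {y ∷ ys} (here refl) = here refl , here refl
∈-zip⁻ {xs = x ∷ xs} {y ∷ ys} (there π∈) with ∈-zip⁻ π∈
... | x∈ , y∈ = there x∈ , there y∈

zip-AllPairs₁ : ∀ {A B : Set} {R : A → A → Set} {xs} {ys : List B} →
                AllPairs R xs → AllPairs (λ π π′ → R (proj₁ π) (proj₁ π′)) (zip xs ys)
zip-AllPairs₁ [] = []
zip-AllPairs₁ {ys = []} (_ ∷ _) = []
zip-AllPairs₁ {ys = y ∷ ys} (Rx ∷ Rxs) = All.tabulate (All.lookup Rx ∘ proj₁ ∘ ∈-zip⁻) ∷ zip-AllPairs₁ Rxs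

zip-AllPairs₂ : ∀ {A B : Set} {R : B → B → Set} {xs : List A} {ys} →
                AllPairs R ys → AllPairs (λ π π′ → R (proj₂ π) (proj₂ π′)) (zip xs ys)
zip-AllPairs₂ {xs = []} _ = []
zip-AllPairs₂ {xs = x ∷ xs} [] = []
zip-AllPairs₂ {xs = x ∷ xs} (Ry ∷ Rys) = All.tabulate (All.lookup Ry ∘ proj₂ ∘ ∈-zip⁻) ∷ zip-AllPairs₂ Rys

length-filter+filter-∁ : ∀ {A : Set} {P : A → Set} (P? : Decidable P) xs →
                         length (filter P? xs) + length (filter (∁? P?) xs) ≡ length xs
length-filter+filter-∁ P? [] = refl
length-filter+filter-∁ P? (x ∷ xs) with P? x
... | yes _ = cong suc (length-filter+filter-∁ P? xs)
... | no _ = trans (+-suc _ _) (cong suc (length-filter+filter-∁ P? xs))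

anyF-intro : ∀ {m} {f : Fin m → Bool} a → f a ≡ true → anyF f ≡ true
anyF-intro zero fa = ∨-introˡ fa
anyF-intro (suc a) fa = ∨-introʳ (anyF-intro a fa)

anyF-elim : ∀ {m} {f : Fin m → Bool} → anyF f ≡ true → Σ (Fin m) λ a → f a ≡ true
anyF-elim {suc m} {f} any with ∨-elim {f zero} any
... | inj₁ f0 = zero , f0
... | inj₂ any′ with anyF-elim any′
...   | a , fa = suc a , fa

allF-intro : ∀ {m} {f : Fin m → Bool} → (∀ i → f i ≡ true) → allF f ≡ true
allF-intro {zero} f≡true = refl
allF-intro {suc m} f≡true = ∧-intro (f≡true zero) (allF-intro (f≡true ∘ suc))

allF-elim : ∀ {m} {f : Fin m → Bool} → allF f ≡ true → ∀ i → f i ≡ true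
allF-elim {suc m} {f} all zero = ∧-conicalˡ (f zero) _ all
allF-elim {suc m} {f} all (suc i) = allF-elim (∧-conicalʳ (f zero) _ all) i

parityF-false : ∀ {m} {f : Fin m → Bool} → (∀ i → f i ≡ false) → parityF f ≡ false
parityF-false {zero} f≡false = refl
parityF-false {suc m} {f} f≡false rewrite f≡false zero = parityF-false (f≡false ∘ suc)

parityF-single : ∀ {m} {f : Fin m → Bool} a → (∀ i → f i ≡ true → i ≡ a) → parityF f ≡ f a
parityF-single {suc m} {f} zero only-a
  rewrite parityF-false {f = f ∘ suc} (λ i → ¬-not (Finₚ.0≢1+n ∘ sym ∘ only-a (suc i))) =
  xor-identityʳ (f zero)
parityF-single {suc m} {f} (suc a) only-a with f zero in f0
... | true with () ← only-a zero f0
... | false = parityF-single a (λ i fi → Finₚ.suc-injective (only-a (suc i) fi))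

allL-intro : ∀ {A : Set} {p : A → Bool} xs → (∀ x → p x ≡ true) → allL p xs ≡ true
allL-intro [] p≡true = refl
allL-intro (x ∷ xs) p≡true = ∧-intro (p≡true x) (allL-intro xs p≡true)

maxList-upper : ∀ {x} xs → x ∈ xs → x ≤ maxList xs
maxList-upper (x ∷ xs) (here refl) = m≤m⊔n x (maxList xs)
maxList-upper (y ∷ xs) (there x∈xs) = ≤-trans (maxList-upper xs x∈xs) (m≤n⊔m y (maxList xs))

allSubsets-complete : ∀ {n} (S : Subset n) → S ∈ allSubsets n
allSubsets-complete [] = here refl
allSubsets-complete {suc n} (false ∷ S) = ∈-++⁺ˡ (∈-map⁺ (false ∷_) (allSubsets-complete S))
allSubsets-complete {suc n} (true ∷ S) =
  ∈-++⁺ʳ (map (false ∷_) (allSubsets n)) (∈-map⁺ (true ∷_) (allSubsets-complete S))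

¬¬-Π-Fin : ∀ {n} {Q : Fin n → Set} → (∀ i → ¬ ¬ Q i) → ¬ ¬ (∀ i → Q i)
¬¬-Π-Fin {zero} _ ¬∀ = ¬∀ λ ()
¬¬-Π-Fin {suc n} ¬¬Q ¬∀ = ¬¬Q zero λ Q₀ → ¬¬-Π-Fin (¬¬Q ∘ suc) λ Qₛ → ¬∀ λ { zero → Q₀ ; (suc i) → Qₛ i }

module _ {n : ℕ} where
  open import Data.List.Membership.DecPropositional (_≟_ {n = n}) using (_∈?_)

  memberF : List (Fin n) → Fin n → Bool
  memberF xs u = does (u ∈? xs)

  memberF-sound : ∀ {xs u} → memberF xs u ≡ true → u ∈ xs
  memberF-sound {xs} {u} = dec-sound (u ∈? xs)

  countF-=F : (x : Fin n) → countF (_=F x) ≡ 1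
  countF-=F x = ≤-antisym (countF-≤1 {n} (λ i j i≡x j≡x → trans (=F⇒≡ i≡x) (sym (=F⇒≡ j≡x))))
                          (countF-witness x (=F-refl x))

  countF-memberF : ∀ xs → Unique xs → countF (memberF xs) ≡ length xs
  countF-memberF [] [] = countF-false {n} (λ _ → refl)
  countF-memberF (x ∷ xs) (x∉xs ∷ xs!) = begin
      countF (memberF (x ∷ xs))
    ≡⟨ countF-split (memberF (x ∷ xs)) (_=F x) ⟩
      countF (λ u → memberF (x ∷ xs) u ∧ (u =F x)) + countF (λ u → memberF (x ∷ xs) u ∧ not (u =F x))
    ≡⟨ cong₂ _+_ (trans (countF-cong at-x) (countF-=F x)) (trans (countF-cong off-x) (countF-memberF xs xs!)) ⟩
      suc (length xs) ∎
    where
    open ≡-Reasoning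
    at-x : ∀ u → memberF (x ∷ xs) u ∧ (u =F x) ≡ (u =F x)
    at-x u with u =F x
    ... | true = refl
    ... | false = ∧-zeroʳ (memberF xs u)
    off-x : ∀ u → memberF (x ∷ xs) u ∧ not (u =F x) ≡ memberF xs u
    off-x u with u ≟ x
    ... | no _ = ∧-identityʳ (memberF xs u)
    ... | yes refl = sym (¬-not (λ x∈ → All.lookup x∉xs (memberF-sound x∈) refl))

module _ (D : Digraph) where
  open Digraph D

  M-complete : ∀ i → M (tail i) (head i) ≡ true
  M-complete i = anyF-intro i (∧-intro (=F-refl (tail i)) (=F-refl (head i)))

  M-sound : ∀ {u v} → M u v ≡ true → Σ (Fin m) λ i → tail i ≡ u × head i ≡ v
  M-sound {u} {v} Muv with anyF-elim Muv
  ... | i , i:u→v = i , =F⇒≡ (∧-conicalˡ (tail i =F u) _ i:u→v) , =F⇒≡ (∧-conicalʳ (tail i =F u) _ i:u→v)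

  ⊆ᵇ-elim : ∀ {T S} → (T ⊆ᵇ S) ≡ true → ∀ v → lookup T v ≡ true → lookup S v ≡ true
  ⊆ᵇ-elim {T} T⊆S v v∈T with allF-elim T⊆S v
  ... | v-ok rewrite v∈T = v-ok

  record IsInducedMatching (R C : Subset n) (ps : List (Fin n × Fin n)) : Set where
    field
      rows-distinct : AllPairs (λ π π′ → proj₁ π ≢ proj₁ π′) ps
      rows-in       : All (λ π → lookup R (proj₁ π) ≡ true) ps
      cols-in       : All (λ π → lookup C (proj₂ π) ≡ true) ps
      matched       : All (λ π → M (proj₁ π) (proj₂ π) ≡ true) ps
      induced       : ∀ {π π′} → π ∈ ps → π′ ∈ ps → M (proj₁ π) (proj₂ π′) ≡ true → proj₁ π ≡ proj₁ π′

  module _ {R C ps} (matching : IsInducedMatching R C ps) where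
    open IsInducedMatching matching

    matchedRows : Subset n
    matchedRows = tabulate (memberF (map proj₁ ps))

    row-of : ∀ {u} → lookup matchedRows u ≡ true → Σ _ λ π → π ∈ ps × proj₁ π ≡ u
    row-of {u} u∈S with ∈-map⁻ proj₁ (memberF-sound (trans (sym (lookup∘tabulate _ u)) u∈S))
    ... | π , π∈ps , refl = π , π∈ps , refl

    matchedRows⊆R : (matchedRows ⊆ᵇ R) ≡ true
    matchedRows⊆R = allF-intro ⊆R-at
      where
      ⊆R-at : ∀ u → not (lookup matchedRows u) ∨ lookup R u ≡ true
      ⊆R-at u with lookup matchedRows u in u∈S
      ... | false = refl
      ... | true with row-of u∈S
      ...   | π , π∈ps , refl = All.lookup rows-in π∈ps

    -- The column matched to a row of T meets T in that row alone.
    odd-column : ∀ T → (T ⊆ᵇ matchedRows) ≡ true → ∀ {π} → π ∈ ps → lookup T (proj₁ π) ≡ true →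
                 parityF (λ v → lookup T v ∧ M v (proj₂ π)) ≡ true
    odd-column T T⊆S {π} π∈ps π∈T =
      trans (parityF-single (proj₁ π) only-π) (∧-intro π∈T (All.lookup matched π∈ps))
      where
      only-π : ∀ v → lookup T v ∧ M v (proj₂ π) ≡ true → v ≡ proj₁ π
      only-π v v∈T∧Mvπ
        with row-of (⊆ᵇ-elim {T} {matchedRows} T⊆S v (∧-conicalˡ (lookup T v) _ v∈T∧Mvπ))
      ... | π′ , π′∈ps , refl = induced π′∈ps π∈ps (∧-conicalʳ (lookup T v) _ v∈T∧Mvπ)

    matchedRows-independent : independent C matchedRows ≡ true
    matchedRows-independent = allL-intro (allSubsets n) independent-at
      where
      independent-at : ∀ T → not ((T ⊆ᵇ matchedRows) ∧ anyF (lookup T))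
                             ∨ anyF (λ c → lookup C c ∧ parityF (λ u → lookup T u ∧ M u c)) ≡ true
      independent-at T with T ⊆ᵇ matchedRows in T⊆S | anyF (lookup T) in T-nonempty
      ... | false | _ = refl
      ... | true | false = refl
      ... | true | true with anyF-elim T-nonempty
      ...   | u , u∈T with row-of (⊆ᵇ-elim {T} {matchedRows} T⊆S u u∈T)
      ...     | π , π∈ps , refl =
        anyF-intro (proj₂ π) (∧-intro (All.lookup cols-in π∈ps) (odd-column T T⊆S π∈ps u∈T))

    ∣matchedRows∣ : ∣ matchedRows ∣ ≡ length ps
    ∣matchedRows∣ = begin
      ∣ matchedRows ∣                     ≡⟨ ∣tabulate∣≡countF (memberF (map proj₁ ps)) ⟩
      countF (memberF (map proj₁ ps))     ≡⟨ countF-memberF _ (AllPairsₚ.map⁺ rows-distinct) ⟩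
      length (map proj₁ ps)               ≡⟨ length-map proj₁ ps ⟩
      length ps                           ∎
      where open ≡-Reasoning

    rk-≥-inducedMatching : length ps ≤ rk R C
    rk-≥-inducedMatching =
      subst (_≤ rk R C) value≡ (maxList-upper _ (∈-map⁺ value (allSubsets-complete matchedRows)))
      where
      value : Subset n → ℕ
      value S = if (S ⊆ᵇ R) ∧ independent C S then ∣ S ∣ else 0
      value≡ : value matchedRows ≡ length ps
      value≡ rewrite matchedRows⊆R | matchedRows-independent = ∣matchedRows∣

unique-suffix : ∀ {A : Set} {xs : List A} pre → Unique (pre ++ xs) → Unique xs
unique-suffix [] xs! = xs!
unique-suffix (x ∷ pre) (_ ∷ xs!) = unique-suffix pre xs!

module _ {k : ℕ} (R : Fin k → Fin k → Set) where
  open import Data.List.Membership.DecPropositional (_≟_ {n = k}) using (_∈?_)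

  Avoiding : Fin k → Fin k → Fin k → Set
  Avoiding y u w = R u w × u ≢ y × w ≢ y

  last-visit : ∀ y {a v} → Star R a v → v ≢ y →
               (a ≢ y × Star (Avoiding y) a v) ⊎ Σ (Fin k) (λ z → R y z × Star (Avoiding y) z v)
  last-visit y ε v≢y = inj₁ (v≢y , ε)
  last-visit y {a} (r ◅ walk) v≢y with last-visit y walk v≢y
  ... | inj₂ later = inj₂ later
  ... | inj₁ (a′≢y , avoiding) with a ≟ y
  ...   | yes refl = inj₂ (_ , r , avoiding)
  ...   | no a≢y = inj₁ (a≢y , (r , a≢y , a′≢y) ◅ avoiding)

  first-visit : ∀ y {a v} → Star R a v → Star R a y ⊎ (a ≢ y × Star (Avoiding y) a v)
  first-visit y {a} walk with a ≟ y
  first-visit y {a} walk | yes refl = inj₁ ε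
  first-visit y {a} ε | no a≢y = inj₂ (a≢y , ε)
  first-visit y {a} (r ◅ walk) | no a≢y with first-visit y walk
  ... | inj₁ to-y = inj₁ (r ◅ to-y)
  ... | inj₂ (a′≢y , avoiding) = inj₂ (a≢y , (r , a≢y , a′≢y) ◅ avoiding)

  -- Path a b xs: a walk from a to b whose vertices other than b are listed in xs.
  data Path : Fin k → Fin k → List (Fin k) → Set where
    stop : ∀ {a} → Path a a []
    step : ∀ {a a′ b xs} → R a a′ → Path a′ b xs → Path a b (a ∷ xs)

  path-suffix : ∀ {u b a suf} pre → Path u b (pre ++ a ∷ suf) → Path a b (a ∷ suf)
  path-suffix [] (step r path) = step r path
  path-suffix (x ∷ pre) (step r path) = path-suffix pre path

  simple-path : ∀ {a b} → Star R a b → Σ (List (Fin k)) λ xs → Path a b xs × Unique xs × b ∉ xs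
  simple-path ε = [] , stop , [] , λ ()
  simple-path {a} {b} (r ◅ walk) with simple-path walk
  ... | xs , path , xs! , b∉xs with a ≟ b
  ...   | yes refl = [] , stop , [] , λ ()
  ...   | no a≢b with a ∈? xs
  ...     | no a∉xs = a ∷ xs , step r path , ¬Any⇒All¬ xs a∉xs ∷ xs! ,
                     λ { (here b≡a) → a≢b (sym b≡a) ; (there b∈xs) → b∉xs b∈xs }
  ...     | yes a∈xs with ∈-∃++ a∈xs
  ...       | pre , suf , refl =
    a ∷ suf , path-suffix pre path , unique-suffix pre xs! , b∉xs ∘ ∈-++⁺ʳ pre

module _ {k : ℕ} (adj : Fin k → Fin k → Bool) where
  open GraphNotions adj

  unique⇒distinct : ∀ {xs} → Unique xs → Distinct xs
  unique⇒distinct [] = []ᵈ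
  unique⇒distinct (x∉xs ∷ xs!) = All≢⇒allL _ x∉xs ∷ᵈ unique⇒distinct xs!
    where
    All≢⇒allL : ∀ {x} ys → All (x ≢_) ys → allL (λ y → not (x =F y)) ys ≡ true
    All≢⇒allL [] [] = refl
    All≢⇒allL (y ∷ ys) (x≢y ∷ x≢ys) rewrite ≢⇒=F-false x≢y = All≢⇒allL ys x≢ys

  distinct⇒unique : ∀ {xs} → Distinct xs → Unique xs
  distinct⇒unique []ᵈ = []
  distinct⇒unique (x∉xs ∷ᵈ xs!) = allL⇒All≢ _ x∉xs ∷ distinct⇒unique xs!
    where
    allL⇒All≢ : ∀ {x} ys → allL (λ y → not (x =F y)) ys ≡ true → All (x ≢_) ys
    allL⇒All≢ [] _ = []
    allL⇒All≢ {x} (y ∷ ys) x∉ =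
      not-=F⇒≢ (∧-conicalˡ (not (x =F y)) _ x∉) ∷ allL⇒All≢ ys (∧-conicalʳ (not (x =F y)) _ x∉)

module Sides (T : SubcubicTree) where
  open SubcubicTree T

  adj-irrefl : ∀ {x y} → Adj x y → x ≢ y
  adj-irrefl {x} xy refl with () ← trans (sym xy) (irrefl x)

  adj-sym′ : ∀ {x y} → Adj x y → Adj y x
  adj-sym′ {x} {y} xy = trans (adj-sym y x) xy

  OnSide : Fin k → Fin k → Fin k → Set
  OnSide x y v = Star (AdjWithout x y) y v

  avoiding-tail : ∀ {x y u w} → Avoiding Adj y u w → AdjWithout x y u w
  avoiding-tail (uw , u≢y , w≢y) = uw , λ { (inj₁ (_ , w≡y)) → w≢y w≡y ; (inj₂ (u≡y , _)) → u≢y u≡y }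

  avoiding-head : ∀ {y z u w} → Avoiding Adj y u w → AdjWithout y z u w
  avoiding-head (uw , u≢y , w≢y) = uw , λ { (inj₁ (u≡y , _)) → u≢y u≡y ; (inj₂ (_ , w≡y)) → w≢y w≡y }

  without⇒avoiding : ∀ {a b y u w} → Avoiding (AdjWithout a b) y u w → Avoiding Adj y u w
  without⇒avoiding ((uw , _) , u≢y , w≢y) = uw , u≢y , w≢y

  path⇒linked : ∀ {R a b xs} → (∀ {u w} → R u w → Adj u w) → Path R a b xs → Linked (xs ++ b ∷ [])
  path⇒linked R⊆Adj stop = [-]
  path⇒linked R⊆Adj (step r stop) = R⊆Adj r ∷ₗ [-]
  path⇒linked R⊆Adj (step r (step r′ path)) = R⊆Adj r ∷ₗ path⇒linked R⊆Adj (step r′ path)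

  -- A walk from z back to y avoiding the edge yz closes a cycle through that edge.
  tail-not-on-side : ∀ {y z} → Adj y z → ¬ OnSide y z y
  tail-not-on-side {y} {z} yz walk with simple-path _ walk
  ... | [] , stop , _ , _ = adj-irrefl yz refl
  ... | _ ∷ [] , step zy stop , _ , _ = proj₂ zy (inj₂ (refl , refl))
  ... | _ ∷ w ∷ rest , step zw path , xs! , y∉xs =
    acyclic (y , z ∷ w ∷ rest , s≤s (s≤s z≤n) ,
             unique⇒distinct adj (¬Any⇒All¬ _ y∉xs ∷ xs!) ,
             yz ∷ₗ path⇒linked proj₁ (step zw path))

  side-nested : ∀ {x y z v} → Adj x y → Adj y z → z ≢ x → OnSide y z v → OnSide x y v
  side-nested {x} {y} {z} xy yz z≢x walk with first-visit (AdjWithout y z) y walk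
  ... | inj₁ back-to-y = ⊥-elim (tail-not-on-side yz back-to-y)
  ... | inj₂ (z≢y , avoiding) =
    (yz , λ { (inj₁ (y≡x , _)) → adj-irrefl xy (sym y≡x) ; (inj₂ (_ , z≡x)) → z≢x z≡x })
    ◅ map⋆ (avoiding-tail ∘ without⇒avoiding) avoiding

  side-step : ∀ {x y v} → Adj x y → OnSide x y v → v ≢ y →
              Σ (Fin k) λ z → Adj y z × z ≢ x × OnSide y z v
  side-step {x} {y} xy walk v≢y with last-visit (AdjWithout x y) y walk v≢y
  ... | inj₁ (y≢y , _) = ⊥-elim (y≢y refl)
  ... | inj₂ (z , (yz , yz≢xy) , avoiding) =
    z , yz , (λ z≡x → yz≢xy (inj₂ (refl , z≡x))) , map⋆ (avoiding-head ∘ without⇒avoiding) avoiding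

  ¬¬-OnSide-decidable : ¬ ¬ (∀ x y v → Dec (OnSide x y v))
  ¬¬-OnSide-decidable = ¬¬-Π-Fin λ x → ¬¬-Π-Fin λ y → ¬¬-Π-Fin λ v → ¬¬-excluded-middle

  neighbour : ∀ {x v} → v ≢ x → Σ (Fin k) (Adj x)
  neighbour {x} {v} v≢x with connected x v
  ... | ε = ⊥-elim (v≢x refl)
  ... | xy ◅ _ = _ , xy

  leaf-neighbour-unique : ∀ {ℓ y z} → IsLeaf ℓ → Adj ℓ y → Adj ℓ z → y ≡ z
  leaf-neighbour-unique {ℓ} {y} {z} leaf ℓy ℓz with y ≟ z
  ... | yes y≡z = y≡z
  ... | no y≢z with ≤-trans (countF-two y z ℓy ℓz y≢z) leaf
  ...   | s≤s ()

  leaf-side : ∀ {ℓ y v} → IsLeaf ℓ → Adj ℓ y → v ≢ ℓ → OnSide ℓ y v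
  leaf-side {ℓ} {y} {v} leaf ℓy v≢ℓ with last-visit Adj ℓ (connected ℓ v) v≢ℓ
  ... | inj₁ (ℓ≢ℓ , _) = ⊥-elim (ℓ≢ℓ refl)
  ... | inj₂ (z , ℓz , avoiding) rewrite leaf-neighbour-unique leaf ℓy ℓz = map⋆ avoiding-head avoiding

two-distinct : ∀ {w} → 2 ≤ w → Σ (Fin w) λ a → Σ (Fin w) λ b → a ≢ b
two-distinct {suc (suc w)} _ = zero , suc zero , λ ()
two-distinct {suc zero} (s≤s ())

2+s≤3[1+s] : ∀ s → 2 + s ≤ 3 * suc s
2+s≤3[1+s] s = s≤s (≤-trans (≤-reflexive (+-comm 1 s)) (+-monoʳ-≤ s (s≤s z≤n)))

heavy-edge-impossible : ∀ s w ω → 3 * suc s ≤ w → w < suc s + ω → ω ≤ 1 + 2 * s → ⊥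
heavy-edge-impossible s w ω 3[s+1]≤w w<s+1+ω ω≤1+2s =
  <-irrefl refl (begin-strict
    3 * suc s             ≤⟨ 3[s+1]≤w ⟩
    w                     <⟨ w<s+1+ω ⟩
    suc s + ω             ≤⟨ +-monoʳ-≤ (suc s) ω≤1+2s ⟩
    suc s + (1 + 2 * s)   <⟨ ≤-reflexive (identity s) ⟩
    3 * suc s             ∎)
  where
  open ≤-Reasoning
  identity : ∀ s → suc (suc s + (1 + 2 * s)) ≡ 3 * suc s
  identity = solve-∀

module BalancedEdge (T : SubcubicTree) (side? : ∀ x y v → Dec (Sides.OnSide T x y v))
                    {w : ℕ} (ι : Fin w → Fin (SubcubicTree.k T)) (ι-injective : ∀ {a b} → ι a ≡ ι b → a ≡ b)
                    (ι-leaf : ∀ a → SubcubicTree.IsLeaf T (ι a)) where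
  open SubcubicTree T
  open Sides T

  onSide : Fin k → Fin k → Fin k → Bool
  onSide x y v = does (side? x y v)

  onSide-sound : ∀ {x y v} → onSide x y v ≡ true → OnSide x y v
  onSide-sound {x} {y} {v} = dec-sound (side? x y v)

  onSide-complete : ∀ {x y v} → OnSide x y v → onSide x y v ≡ true
  onSide-complete {x} {y} {v} = dec-true (side? x y v)

  size : Fin k → Fin k → ℕ
  size x y = countF (onSide x y)

  size-decreasing : ∀ {x y z} → Adj x y → Adj y z → z ≢ x → size y z < size x y
  size-decreasing {x} {y} {z} xy yz z≢x =
    countF-mono-< {k} {onSide y z} {onSide x y} y (λ v → onSide-complete ∘ side-nested xy yz z≢x ∘ onSide-sound)
      (onSide-complete ε) (¬-not (tail-not-on-side yz ∘ onSide-sound))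

  children : Fin k → Fin k → List (Fin k)
  children x y = support (λ z → adj y z ∧ not (z =F x))

  ∈-children⁻ : ∀ {x y z} → z ∈ children x y → Adj y z × z ≢ x
  ∈-children⁻ {x} {y} {z} z∈ with ∈-support⁻ _ z∈
  ... | yz∧z≢x = ∧-conicalˡ (adj y z) _ yz∧z≢x , not-=F⇒≢ (∧-conicalʳ (adj y z) _ yz∧z≢x)

  length-children : ∀ {x y} → Adj x y → length (children x y) ≤ 2
  length-children {x} {y} xy rewrite length-support (λ z → adj y z ∧ not (z =F x)) =
    +-cancelˡ-≤ 1 _ 2 (begin
      1 + countF (λ z → adj y z ∧ not (z =F x))
        ≤⟨ +-monoˡ-≤ _ (countF-witness x (∧-intro (adj-sym′ xy) (=F-refl x))) ⟩
      countF (λ z → adj y z ∧ (z =F x)) + countF (λ z → adj y z ∧ not (z =F x))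
        ≡⟨ sym (countF-split (adj y) (_=F x)) ⟩
      degree y
        ≤⟨ maxdeg≤3 y ⟩
      3 ∎)
    where open ≤-Reasoning

  weight : Fin k → Fin k → ℕ
  weight x y = countF (λ a → onSide x y (ι a))

  Balanced : ℕ → Set
  Balanced s = Σ (Fin k) λ x → Σ (Fin k) λ y → Adj x y × suc s ≤ weight x y × suc s + weight x y ≤ w

  at-most-one-at : ∀ v → countF (λ a → ι a =F v) ≤ 1
  at-most-one-at v = countF-≤1 (λ a b a↦v b↦v → ι-injective (trans (=F⇒≡ a↦v) (sym (=F⇒≡ b↦v))))

  weight-split : ∀ {x y} → Adj x y → weight x y ≤ 1 + sum (map (weight y) (children x y))
  weight-split {x} {y} xy =
    ≤-trans (countF-mono at-y-or-below)
      (≤-trans (countF-∨ (λ a → ι a =F y) _)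
        (+-mono-≤ (at-most-one-at y) (countF-any≤sum (λ z a → onSide y z (ι a)) (children x y))))
    where
    at-y-or-below : ∀ a → onSide x y (ι a) ≡ true →
                    (ι a =F y) ∨ any (λ z → onSide y z (ι a)) (children x y) ≡ true
    at-y-or-below a on with ι a ≟ y
    ... | yes _ = refl
    ... | no ιa≢y with side-step xy (onSide-sound on) ιa≢y
    ...   | z , yz , z≢x , on′ = any-intro (∈-support⁺ z (∧-intro yz (cong not (≢⇒=F-false z≢x))))
                                           (onSide-complete on′)

  leaf-edge-weight : ∀ a {y} → Adj (ι a) y → w ≤ 1 + weight (ι a) y
  leaf-edge-weight a {y} ιa-y = begin
    w                                                      ≡⟨ sym (countF-true w) ⟩
    countF {w} (λ _ → true)                                ≤⟨ countF-mono at-ιa-or-beyond ⟩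
    countF (λ b → (ι b =F ι a) ∨ onSide (ι a) y (ι b))     ≤⟨ countF-∨ (λ b → ι b =F ι a) _ ⟩
    countF (λ b → ι b =F ι a) + weight (ι a) y             ≤⟨ +-monoˡ-≤ _ (at-most-one-at (ι a)) ⟩
    1 + weight (ι a) y                                     ∎
    where
    open ≤-Reasoning
    at-ιa-or-beyond : ∀ b → true ≡ true → (ι b =F ι a) ∨ onSide (ι a) y (ι b) ≡ true
    at-ιa-or-beyond b _ with ι b ≟ ι a
    ... | yes _ = refl
    ... | no ιb≢ιa = onSide-complete (leaf-side (ι-leaf a) ιa-y ιb≢ιa)

  module _ (s : ℕ) (3[s+1]≤w : 3 * suc s ≤ w) where

    -- Walk away from a leaf along heavy edges; the sides shrink, and an edge that is
    -- heavy but not balanced always has a heavy child, as y has at most two children.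
    descend : ∀ fuel x y → Adj x y → size x y < fuel → suc s ≤ weight x y → Balanced s
    descend (suc fuel) x y xy size<fuel heavy with suc s + weight x y ≤? w
    ... | yes rest-heavy = x , y , xy , heavy , rest-heavy
    ... | no rest-light with any? (λ z → suc s ≤? weight y z) (children x y)
    ...   | yes heavy-child with find heavy-child
    ...     | z , z∈ , heavy-z with ∈-children⁻ z∈
    ...       | yz , z≢x = descend fuel y z yz (≤-trans (size-decreasing xy yz z≢x) (≤-pred size<fuel)) heavy-z
    descend (suc fuel) x y xy _ heavy | no rest-light | no light-children =
      ⊥-elim (heavy-edge-impossible s w (weight x y) 3[s+1]≤w (≰⇒> rest-light) (begin
        weight x y                                   ≤⟨ weight-split xy ⟩
        1 + sum (map (weight y) (children x y))      ≤⟨ s≤s (sum-map-≤ (weight y) (children x y) light) ⟩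
        1 + length (children x y) * s                ≤⟨ s≤s (*-monoˡ-≤ s (length-children xy)) ⟩
        1 + 2 * s                                    ∎))
      where
      open ≤-Reasoning
      light : ∀ {z} → z ∈ children x y → weight y z ≤ s
      light z∈ = ≤-pred (≰⇒> (light-children ∘ lose z∈))

    balanced-edge : Balanced s
    balanced-edge with two-distinct (≤-trans (≤-trans (m≤m+n 2 s) (2+s≤3[1+s] s)) 3[s+1]≤w)
    ... | a , b , a≢b with neighbour {ι a} (a≢b ∘ ι-injective ∘ sym)
    ...   | y , ιa-y = descend (suc (size (ι a) y)) (ι a) y ιa-y ≤-refl heavy
      where
      heavy : suc s ≤ weight (ι a) y
      heavy = +-cancelˡ-≤ 1 _ _ (≤-trans (2+s≤3[1+s] s) (≤-trans 3[s+1]≤w (leaf-edge-weight a ιa-y)))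

Separates : ∀ {m w} → ℕ → (Fin w → Fin m) → Subset m → Set
Separates s ι Y = suc s ≤ countF (λ a → lookup Y (ι a)) × suc s ≤ countF (λ a → not (lookup Y (ι a)))

module _ {m} (L : Layout m) where
  open Layout L
  open Sides tree

  private
    leafOf : Fin m → Leaf
    leafOf = Bijection.to⁻ β

    β∘leafOf : ∀ i → β⟨ leafOf i ⟩ ≡ i
    β∘leafOf i = proj₂ (Bijection.strictlySurjective β i)

    leafOf∘β : ∀ ℓ → leafOf β⟨ ℓ ⟩ ≡ ℓ
    leafOf∘β ℓ = Bijection.injective β (β∘leafOf β⟨ ℓ ⟩)

    leaf-≡ : ∀ {ℓ ℓ′ : Leaf} → proj₁ ℓ ≡ proj₁ ℓ′ → ℓ ≡ ℓ′
    leaf-≡ {v , p} {.v , q} refl = cong (v ,_) (≤-irrelevant p q)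

    vertexOf : Fin m → Fin k
    vertexOf i = proj₁ (leafOf i)

    vertexOf-injective : ∀ {i j} → vertexOf i ≡ vertexOf j → i ≡ j
    vertexOf-injective {i} {j} e = trans (sym (β∘leafOf i)) (trans (cong β⟨_⟩ (leaf-≡ e)) (β∘leafOf j))

  separating-edge : (∀ x y v → Dec (OnSide x y v)) →
                    ∀ {w} (ι : Fin w → Fin m) → (∀ {a b} → ι a ≡ ι b → a ≡ b) →
                    ∀ s → 3 * suc s ≤ w →
                    Σ (Fin k) λ x → Σ (Fin k) λ y → Adj x y × Σ (Subset m) λ Y → IsSide x y Y × Separates s ι Y
  separating-edge side? {w} ι ι-injective s 3[s+1]≤w =
    separating (balanced-edge s 3[s+1]≤w)
    where
    open BalancedEdge tree side? (vertexOf ∘ ι) (ι-injective ∘ vertexOf-injective) (proj₂ ∘ leafOf ∘ ι)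

    separating : Balanced s →
                 Σ (Fin k) λ x → Σ (Fin k) λ y → Adj x y × Σ (Subset m) λ Y → IsSide x y Y × Separates s ι Y
    separating (x , y , xy , heavy , rest-heavy) = x , y , xy , Y , side , inside , outside
      where
      Y : Subset m
      Y = tabulate (onSide x y ∘ vertexOf)

      Y-at-leaf : ∀ ℓ → lookup Y β⟨ ℓ ⟩ ≡ onSide x y (proj₁ ℓ)
      Y-at-leaf ℓ = trans (lookup∘tabulate _ β⟨ ℓ ⟩) (cong (onSide x y ∘ proj₁) (leafOf∘β ℓ))

      side : IsSide x y Y
      side ℓ = (λ ℓ∈Y → onSide-sound (trans (sym (Y-at-leaf ℓ)) ℓ∈Y))
             , (λ on → trans (Y-at-leaf ℓ) (onSide-complete on))

      count-Y : countF (λ a → lookup Y (ι a)) ≡ weight x y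
      count-Y = countF-cong (λ a → lookup∘tabulate _ (ι a))

      inside : suc s ≤ countF (λ a → lookup Y (ι a))
      inside = subst (suc s ≤_) (sym count-Y) heavy

      outside : suc s ≤ countF (λ a → not (lookup Y (ι a)))
      outside = +-cancelˡ-≤ (countF (λ a → lookup Y (ι a))) _ _ (begin
        countF (λ a → lookup Y (ι a)) + suc s   ≡⟨ +-comm _ (suc s) ⟩
        suc s + countF (λ a → lookup Y (ι a))   ≡⟨ cong (suc s +_) count-Y ⟩
        suc s + weight x y                      ≤⟨ rest-heavy ⟩
        w                                       ≡⟨ sym (countF-+-not (λ a → lookup Y (ι a))) ⟩
        countF (λ a → lookup Y (ι a)) + countF (λ a → not (lookup Y (ι a))) ∎)
        where open ≤-Reasoning

  -- The side of an edge need not be decidable constructively, hence the double negation.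
  ¬¬-width-≥-separation : ∀ {w} (ι : Fin w → Fin m) → (∀ {a b} → ι a ≡ ι b → a ≡ b) →
                          ∀ s → 3 * suc s ≤ w →
                          ∀ (f : Subset m → ℕ) {K} → (∀ Y → Separates s ι Y → K ≤ f Y) →
                          ∀ {j} → WidthAtMost f L j → ¬ ¬ (K ≤ j)
  ¬¬-width-≥-separation ι ι-injective s 3[s+1]≤w f bound width≤j = ¬¬-map width-≥ ¬¬-OnSide-decidable
    where
    width-≥ : (∀ x y v → Dec (OnSide x y v)) → _
    width-≥ side? =
      let x , y , xy , Y , side , separates = separating-edge side? ι ι-injective s 3[s+1]≤w
      in ≤-trans (bound Y separates) (width≤j x y xy Y side)

module ParentGraph {k : ℕ} (adj : Fin k → Fin k → Bool)
  (Parent : Fin k → Fin k → Set) (rank : Fin k → ℕ)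
  (edge⇒parent : ∀ {u v} → adj u v ≡ true → Parent u v ⊎ Parent v u)
  (parent-unique : ∀ {u v w} → Parent u v → Parent u w → v ≡ w)
  (parent-rank : ∀ {u v} → Parent u v → rank v < rank u) where
  open GraphNotions adj

  NonBacktracking : List (Fin k) → Set
  NonBacktracking (x ∷ y ∷ z ∷ zs) = x ≢ z × NonBacktracking (y ∷ z ∷ zs)
  NonBacktracking _ = ⊤

  last : Fin k → List (Fin k) → Fin k
  last x [] = x
  last x (y ∷ ys) = last y ys

  -- EndsDownward x y ys: the last step of the walk x ∷ y ∷ ys goes from a parent to its child.
  EndsDownward : Fin k → Fin k → List (Fin k) → Set
  EndsDownward x y [] = Parent y x
  EndsDownward x y (z ∷ zs) = EndsDownward y z zs

  -- Once a non-backtracking walk steps down it can never step up again.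
  downward-forever : ∀ {x y} ys → Linked (x ∷ y ∷ ys) → NonBacktracking (x ∷ y ∷ ys) → Parent y x →
                     rank x < rank (last y ys) × EndsDownward x y ys
  downward-forever [] _ _ y↑x = parent-rank y↑x , y↑x
  downward-forever (z ∷ zs) (_ ∷ₗ rest@(yz ∷ₗ _)) (x≢z , nb) y↑x with edge⇒parent yz
  ... | inj₁ y↑z = ⊥-elim (x≢z (parent-unique y↑x y↑z))
  ... | inj₂ z↑y with downward-forever zs rest nb z↑y
  ...   | y<last , ends-down = <-trans (parent-rank y↑x) y<last , ends-down

  upward-or-ends-downward : ∀ {x y} ys → Linked (x ∷ y ∷ ys) → NonBacktracking (x ∷ y ∷ ys) →
                            rank (last y ys) < rank x ⊎ EndsDownward x y ys
  upward-or-ends-downward [] (xy ∷ₗ _) _ with edge⇒parent xy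
  ... | inj₁ x↑y = inj₁ (parent-rank x↑y)
  ... | inj₂ y↑x = inj₂ y↑x
  upward-or-ends-downward (z ∷ zs) walk@(xy ∷ₗ rest) nb with edge⇒parent xy
  ... | inj₂ y↑x = inj₂ (proj₂ (downward-forever (z ∷ zs) walk nb y↑x))
  ... | inj₁ x↑y with upward-or-ends-downward zs rest (proj₂ nb)
  ...   | inj₁ last<y = inj₁ (<-trans last<y (parent-rank x↑y))
  ...   | inj₂ ends-down = inj₂ ends-down

  private
    last-++ : ∀ x ys v → last x (ys ++ v ∷ []) ≡ v
    last-++ x [] v = refl
    last-++ x (y ∷ ys) v = last-++ y ys v

    endsDownward-++ : ∀ {v} x y zs → EndsDownward x y (zs ++ v ∷ []) → Parent v (last y zs)
    endsDownward-++ x y [] ends-down = ends-down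
    endsDownward-++ x y (z ∷ zs) ends-down = endsDownward-++ y z zs ends-down

    last-∈ : ∀ y zs → last y zs ∈ y ∷ zs
    last-∈ y [] = here refl
    last-∈ y (z ∷ zs) = there (last-∈ z zs)

    unique⇒nonBacktracking : ∀ {xs} → Unique xs → NonBacktracking xs
    unique⇒nonBacktracking {[]} _ = tt
    unique⇒nonBacktracking {_ ∷ []} _ = tt
    unique⇒nonBacktracking {_ ∷ _ ∷ []} _ = tt
    unique⇒nonBacktracking {_ ∷ _ ∷ _ ∷ _} ((_ ∷ x≢z ∷ _) ∷ yzs!) = x≢z , unique⇒nonBacktracking yzs!

    closed-nonBacktracking : ∀ {v w₁ w₂} rest → Unique (v ∷ w₁ ∷ w₂ ∷ rest) →
                             NonBacktracking (v ∷ w₁ ∷ w₂ ∷ rest ++ v ∷ [])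
    closed-nonBacktracking rest (v∉ws@(_ ∷ v≢w₂ ∷ _) ∷ ws!) =
      v≢w₂ , unique⇒nonBacktracking
               (Uniqueₚ.++⁺ ws! ([] ∷ []) λ { (v∈ws , here refl) → All.lookup v∉ws v∈ws refl })

  acyclic : ¬ HasCycle
  acyclic (_ , _ ∷ [] , s≤s () , _)
  acyclic (v , w₁ ∷ w₂ ∷ rest , _ , distinct , walk@(vw₁ ∷ₗ _))
    with distinct⇒unique adj distinct
  ... | vws!@(_ ∷ (w₁∉ ∷ _)) with closed-nonBacktracking rest vws! | edge⇒parent vw₁
  ...   | nb | inj₂ w₁↑v = <-irrefl (cong rank (sym (last-++ w₁ (w₂ ∷ rest) v)))
                                    (proj₁ (downward-forever (w₂ ∷ rest ++ v ∷ []) walk nb w₁↑v))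
  ...   | nb | inj₁ v↑w₁ with upward-or-ends-downward (w₂ ∷ rest ++ v ∷ []) walk nb
  ...     | inj₁ v<v = <-irrefl (cong rank (last-++ w₁ (w₂ ∷ rest) v)) v<v
  ...     | inj₂ ends-down =
    All.lookup w₁∉ (last-∈ w₂ rest) (parent-unique v↑w₁ (endsDownward-++ v w₁ (w₂ ∷ rest) ends-down))

predecessor : ∀ {n} → n ≢ 0 → Σ ℕ λ i → suc i ≡ n
predecessor {zero} n≢0 = ⊥-elim (n≢0 refl)
predecessor {suc i} _ = i , refl

module Caterpillar (N′ : ℕ) where
  N K : ℕ
  N = suc (suc N′)
  K = N + N

  -- Vertices 0, …, N - 1 form the spine, with parent(u) = u - 1; vertex N + j is a leaf below j.
  Parent : Fin K → Fin K → Set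
  Parent u v = (suc (toℕ v) ≡ toℕ u × toℕ u < N) ⊎ (toℕ v + N ≡ toℕ u × N ≤ toℕ u)

  parent? : ∀ u v → Dec (Parent u v)
  parent? u v = ((suc (toℕ v) ≟ℕ toℕ u) ×-dec (toℕ u <? N)) ⊎-dec ((toℕ v + N ≟ℕ toℕ u) ×-dec (N ≤? toℕ u))

  isParent : Fin K → Fin K → Bool
  isParent u v = does (parent? u v)

  isParent-sound : ∀ {u v} → isParent u v ≡ true → Parent u v
  isParent-sound {u} {v} = dec-sound (parent? u v)

  isParent-complete : ∀ {u v} → Parent u v → isParent u v ≡ true
  isParent-complete {u} {v} = dec-true (parent? u v)

  adjacent : Fin K → Fin K → Bool
  adjacent u v = isParent u v ∨ isParent v u

  edge⇒parent : ∀ {u v} → adjacent u v ≡ true → Parent u v ⊎ Parent v u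
  edge⇒parent {u} e with ∨-elim {isParent u _} e
  ... | inj₁ u↑v = inj₁ (isParent-sound u↑v)
  ... | inj₂ v↑u = inj₂ (isParent-sound v↑u)

  parent-unique : ∀ {u v w} → Parent u v → Parent u w → v ≡ w
  parent-unique (inj₁ (e , _)) (inj₁ (e′ , _)) = toℕ-injective (suc-injective (trans e (sym e′)))
  parent-unique (inj₂ (e , _)) (inj₂ (e′ , _)) = toℕ-injective (+-cancelʳ-≡ N _ _ (trans e (sym e′)))
  parent-unique (inj₁ (_ , u<N)) (inj₂ (_ , N≤u)) = ⊥-elim (<⇒≱ u<N N≤u)
  parent-unique (inj₂ (_ , N≤u)) (inj₁ (_ , u<N)) = ⊥-elim (<⇒≱ u<N N≤u)

  parent-rank : ∀ {u v} → Parent u v → toℕ v < toℕ u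
  parent-rank (inj₁ (e , _)) = ≤-reflexive e
  parent-rank {u} {v} (inj₂ (e , _)) = subst (toℕ v <_) e (m<m+n (toℕ v) (s≤s z≤n))

  adjacent-irrefl : ∀ u → adjacent u u ≡ false
  adjacent-irrefl u = ¬-not λ uu → <-irrefl refl (parent-rank ([ id , id ]′ (edge⇒parent {u} {u} uu)))

  adjacent-sym : ∀ u v → adjacent u v ≡ adjacent v u
  adjacent-sym u v = ∨-comm (isParent u v) (isParent v u)

  open GraphNotions adjacent

  vertex : ∀ {i} → i < K → Σ (Fin K) λ u → toℕ u ≡ i
  vertex i<K = fromℕ< i<K , toℕ-fromℕ< i<K

  at-most-one-parent : ∀ v → countF (isParent v) ≤ 1
  at-most-one-parent v =
    countF-≤1 {K} {isParent v} λ u w v↑u v↑w → parent-unique (isParent-sound v↑u) (isParent-sound v↑w)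

  at-most-two-children : ∀ v → countF (λ u → isParent u v) ≤ 2
  at-most-two-children v =
    ≤-trans (countF-∨ {K} (λ u → does (spine-child? u)) (λ u → does (leaf-child? u)))
            (+-mono-≤ (countF-≤1 (λ u w → unique-spine-child)) (countF-≤1 λ u w → unique-leaf-child))
    where
    spine-child? : ∀ u → Dec (suc (toℕ v) ≡ toℕ u × toℕ u < N)
    spine-child? u = (suc (toℕ v) ≟ℕ toℕ u) ×-dec (toℕ u <? N)
    leaf-child? : ∀ u → Dec (toℕ v + N ≡ toℕ u × N ≤ toℕ u)
    leaf-child? u = (toℕ v + N ≟ℕ toℕ u) ×-dec (N ≤? toℕ u)
    unique-spine-child : ∀ {u w} → does (spine-child? u) ≡ true → does (spine-child? w) ≡ true → u ≡ w
    unique-spine-child {u} {w} u-child w-child =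
      toℕ-injective (trans (sym (proj₁ (dec-sound (spine-child? u) u-child)))
                           (proj₁ (dec-sound (spine-child? w) w-child)))
    unique-leaf-child : ∀ {u w} → does (leaf-child? u) ≡ true → does (leaf-child? w) ≡ true → u ≡ w
    unique-leaf-child {u} {w} u-child w-child =
      toℕ-injective (trans (sym (proj₁ (dec-sound (leaf-child? u) u-child)))
                           (proj₁ (dec-sound (leaf-child? w) w-child)))

  degree≤3 : ∀ v → degree v ≤ 3
  degree≤3 v = ≤-trans (countF-∨ (isParent v) (λ u → isParent u v))
                       (+-mono-≤ (at-most-one-parent v) (at-most-two-children v))

  parent-exists : ∀ u → toℕ u ≢ 0 → Σ (Fin K) (Parent u)
  parent-exists u u≢0 with toℕ u <? N
  ... | yes u<N with predecessor u≢0
  ...   | i , 1+i≡u with vertex {i} (≤-trans (n≤1+n _) (≤-trans (subst (_< N) (sym 1+i≡u) u<N) (m≤m+n N N)))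
  ...     | v , v≡i = v , inj₁ (trans (cong suc v≡i) 1+i≡u , u<N)
  parent-exists u u≢0 | no u≮N with m≤n⇒∃[o]m+o≡n (≮⇒≥ u≮N)
  ...   | i , N+i≡u with vertex {i} (≤-trans (+-cancelˡ-< N i N (subst (_< K) (sym N+i≡u) (toℕ<n u))) (m≤m+n N N))
  ...     | v , v≡i = v , inj₂ (trans (cong (_+ N) v≡i) (trans (+-comm i N) N+i≡u) , ≮⇒≥ u≮N)

  childless : ∀ {v} → N ≤ toℕ v → ∀ u → ¬ Parent u v
  childless {v} N≤v u (inj₁ (v+1≡u , u<N)) = <⇒≱ u<N (≤-trans N≤v (≤-trans (n≤1+n _) (≤-reflexive v+1≡u)))
  childless {v} N≤v u (inj₂ (v+N≡u , _)) = <⇒≱ (subst (_< K) (sym v+N≡u) (toℕ<n u)) (+-monoˡ-≤ N N≤v)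

  leaf-if : ∀ {v} → N ≤ toℕ v → IsLeaf v
  leaf-if {v} N≤v = ≤-trans (countF-mono only-parent) (at-most-one-parent v)
    where
    only-parent : ∀ u → adjacent v u ≡ true → isParent v u ≡ true
    only-parent u vu with edge⇒parent {v} vu
    ... | inj₁ v↑u = isParent-complete v↑u
    ... | inj₂ u↑v = ⊥-elim (childless N≤v u u↑v)

  spine-neighbour : ∀ {v} → toℕ v < N → Σ (Fin K) λ c → adjacent v c ≡ true × toℕ c < N
  spine-neighbour {v} v<N with suc (toℕ v) <? N
  ... | yes v+1<N with vertex (≤-trans v+1<N (m≤m+n N N))
  ...   | c , c≡v+1 = c , ∨-introʳ {isParent v c} (isParent-complete (inj₁ (sym c≡v+1 , c<N))) , c<N
    where c<N = subst (_< N) (sym c≡v+1) v+1<N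
  spine-neighbour {v} v<N | no v+1≮N
    with parent-exists v (λ v≡0 → v+1≮N (subst (λ i → suc i < N) (sym v≡0) (s≤s (s≤s z≤n))))
  ...   | c , v↑c = c , ∨-introˡ (isParent-complete v↑c) , <-trans (parent-rank v↑c) v<N

  -- A spine vertex is adjacent to its leaf and to a spine neighbour.
  spine-not-leaf : ∀ {v} → toℕ v < N → ¬ IsLeaf v
  spine-not-leaf {v} v<N leaf with vertex (+-monoˡ-< N v<N) | spine-neighbour v<N
  ... | ℓ , ℓ≡v+N | c , vc , c<N = <⇒≱ (s≤s (s≤s z≤n)) (≤-trans (countF-two ℓ c vℓ vc ℓ≢c) leaf)
    where
    N≤ℓ : N ≤ toℕ ℓ
    N≤ℓ = subst (N ≤_) (sym ℓ≡v+N) (m≤n+m N (toℕ v))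
    vℓ : adjacent v ℓ ≡ true
    vℓ = ∨-introʳ {isParent v ℓ} (isParent-complete (inj₂ (sym ℓ≡v+N , N≤ℓ)))
    ℓ≢c : ℓ ≢ c
    ℓ≢c ℓ≡c = <⇒≱ c<N (subst (λ u → N ≤ toℕ u) ℓ≡c N≤ℓ)

  leaf⇒N≤ : ∀ {v} → IsLeaf v → N ≤ toℕ v
  leaf⇒N≤ {v} leaf with N ≤? toℕ v
  ... | yes N≤v = N≤v
  ... | no N≰v = ⊥-elim (spine-not-leaf (≰⇒> N≰v) leaf)

  root : Fin K
  root = zero

  path-to-root : ∀ fuel u → toℕ u < fuel → Star Adj u root
  path-to-root (suc fuel) u u<fuel with toℕ u ≟ℕ 0
  ... | yes u≡0 = subst (λ w → Star Adj w root) (toℕ-injective {i = root} (sym u≡0)) ε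
  ... | no u≢0 with parent-exists u u≢0
  ...   | v , u↑v =
    ∨-introˡ (isParent-complete u↑v) ◅ path-to-root fuel v (≤-trans (parent-rank u↑v) (≤-pred u<fuel))

  connected : ∀ u v → Star Adj u v
  connected u v =
    path-to-root K u (toℕ<n u) ◅◅ reverse (λ {x} {y} xy → trans (adjacent-sym y x) xy) (path-to-root K v (toℕ<n v))

  tree : SubcubicTree
  tree = record
    { k = K ; adj = adjacent ; adj-sym = adjacent-sym ; irrefl = adjacent-irrefl
    ; nonempty = s≤s z≤n ; connected = connected
    ; acyclic = ParentGraph.acyclic adjacent Parent toℕ edge⇒parent parent-unique parent-rank
    ; maxdeg≤3 = degree≤3 }

  leafIndex : Leaf → Fin N
  leafIndex (v , leaf) = reduce≥ v (leaf⇒N≤ leaf)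

  ↑ʳ-leafIndex : ∀ ℓ → N ↑ʳ leafIndex ℓ ≡ proj₁ ℓ
  ↑ʳ-leafIndex (v , leaf) = trans (cong (join N N) (sym (splitAt-≥ N v (leaf⇒N≤ leaf)))) (join-splitAt N N v)

  leafIndex-injective : ∀ {ℓ ℓ′} → leafIndex ℓ ≡ leafIndex ℓ′ → ℓ ≡ ℓ′
  leafIndex-injective {v , p} {v′ , p′} e
    with trans (sym (↑ʳ-leafIndex (v , p))) (trans (cong (N ↑ʳ_) e) (↑ʳ-leafIndex (v′ , p′)))
  ... | refl = cong (v ,_) (≤-irrelevant p p′)

  leafIndex-surjective : ∀ j → Σ Leaf λ ℓ → ∀ {ℓ′} → ℓ′ ≡ ℓ → leafIndex ℓ′ ≡ j
  leafIndex-surjective j =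
    (N ↑ʳ j , leaf-if N≤) , λ { refl → inj₂-injective (trans (sym (splitAt-≥ N (N ↑ʳ j) N≤)) (splitAt-↑ʳ N N j)) }
    where
    N≤ : N ≤ toℕ (N ↑ʳ j)
    N≤ = subst (N ≤_) (sym (toℕ-↑ʳ N j)) (m≤m+n N (toℕ j))

  layout : Layout N
  layout = record { tree = tree ; β = mk⤖ (leafIndex-injective , leafIndex-surjective) }

module _ (D : Digraph) where
  open Digraph D

  fD≡0 : (∀ i j → head i ≢ tail j) → ∀ X → fD X ≡ 0
  fD≡0 no-2-path X =
    trans (∣tabulate∣≡countF (λ y → inS X y ∨ inS (∁ X) y))
          (countF-false λ y → cong₂ _∨_ (not-inS X y) (not-inS (∁ X) y))
    where
    not-inS : ∀ B y → inS B y ≡ false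
    not-inS B y = ¬-not λ y∈S →
      let into-y = λ i → not (lookup B i) ∧ (head i =F y)
          i , i↦y = anyF-elim (∧-conicalˡ (anyF into-y) _ y∈S)
          j , y↦j = anyF-elim (∧-conicalʳ (anyF into-y) _ y∈S)
      in no-2-path i j (trans (=F⇒≡ (∧-conicalʳ (not (lookup B i)) _ i↦y))
                              (sym (=F⇒≡ (∧-conicalʳ (lookup B j) _ y↦j))))

  dbw≡0 : (∀ i j → head i ≢ tail j) → Layout m → IsDbw D 0
  dbw≡0 no-2-path L = (L , λ _ _ _ X _ → ≤-reflexive (fD≡0 no-2-path X)) , λ _ _ _ → z≤n

↑ˡ≢↑ʳ : ∀ {a b} (i : Fin a) (j : Fin b) → i ↑ˡ b ≢ a ↑ʳ j
↑ˡ≢↑ʳ {a} {b} i j e with trans (sym (splitAt-↑ˡ a i b)) (trans (cong (splitAt a) e) (splitAt-↑ʳ a b j))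
... | ()

-- Vertices: n left, n right and n² middle ones; middle (combine i j) receives an edge from
-- left i and one from right j.
module SubdividedBiclique (n : ℕ) where
  V E : ℕ
  V = n + (n + n * n)
  E = n * n + n * n

  left right : Fin n → Fin V
  left i = i ↑ˡ (n + n * n)
  right j = n ↑ʳ (j ↑ˡ (n * n))

  middle : Fin (n * n) → Fin V
  middle p = n ↑ʳ (n ↑ʳ p)

  row col : Fin (n * n) → Fin n
  row p = proj₁ (remQuot {n} n p)
  col p = proj₂ (remQuot {n} n p)

  left≢right : ∀ i j → left i ≢ right j
  left≢right i j = ↑ˡ≢↑ʳ i (j ↑ˡ n * n)

  left≢middle : ∀ i p → left i ≢ middle p
  left≢middle i p = ↑ˡ≢↑ʳ i (n ↑ʳ p)

  right≢middle : ∀ j p → right j ≢ middle p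
  right≢middle j p = ↑ˡ≢↑ʳ j p ∘ ↑ʳ-injective n _ _

  left-injective : ∀ {i i′} → left i ≡ left i′ → i ≡ i′
  left-injective = ↑ˡ-injective (n + n * n) _ _

  right-injective : ∀ {j j′} → right j ≡ right j′ → j ≡ j′
  right-injective = ↑ˡ-injective (n * n) _ _ ∘ ↑ʳ-injective n _ _

  middle-injective : ∀ {p p′} → middle p ≡ middle p′ → p ≡ p′
  middle-injective = ↑ʳ-injective n _ _ ∘ ↑ʳ-injective n _ _

  fromLeft fromRight : Fin (n * n) → Fin V × Fin V
  fromLeft p = left (row p) , middle p
  fromRight p = right (col p) , middle p

  edge : Fin E → Fin V × Fin V
  edge e = [ fromLeft , fromRight ]′ (splitAt (n * n) e)

  EdgeView : Fin E → Set
  EdgeView e = (Σ (Fin (n * n)) λ p → e ≡ p ↑ˡ n * n × edge e ≡ fromLeft p)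
             ⊎ (Σ (Fin (n * n)) λ p → e ≡ n * n ↑ʳ p × edge e ≡ fromRight p)

  edgeView : ∀ e → EdgeView e
  edgeView e with splitAt (n * n) e in e≡
  ... | inj₁ p = inj₁ (p , trans (sym (join-splitAt (n * n) (n * n) e)) (cong (join (n * n) (n * n)) e≡) , refl)
  ... | inj₂ p = inj₂ (p , trans (sym (join-splitAt (n * n) (n * n) e)) (cong (join (n * n) (n * n)) e≡) , refl)

  edge-injective : ∀ {e e′} → edge e ≡ edge e′ → e ≡ e′
  edge-injective {e} {e′} same with edgeView e | edgeView e′
  ... | inj₁ (p , refl , d) | inj₁ (p′ , refl , d′) =
    cong (_↑ˡ n * n) (middle-injective (cong proj₂ (trans (sym d) (trans same d′))))
  ... | inj₂ (p , refl , d) | inj₂ (p′ , refl , d′) =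
    cong (n * n ↑ʳ_) (middle-injective (cong proj₂ (trans (sym d) (trans same d′))))
  ... | inj₁ (_ , _ , d) | inj₂ (_ , _ , d′) =
    ⊥-elim (left≢right _ _ (cong proj₁ (trans (sym d) (trans same d′))))
  ... | inj₂ (_ , _ , d) | inj₁ (_ , _ , d′) =
    ⊥-elim (left≢right _ _ (cong proj₁ (trans (sym d′) (trans (sym same) d))))

  head-middle : ∀ e → Σ (Fin (n * n)) λ p → proj₂ (edge e) ≡ middle p
  head-middle e with edgeView e
  ... | inj₁ (p , _ , d) = p , cong proj₂ d
  ... | inj₂ (p , _ , d) = p , cong proj₂ d

  tail-not-middle : ∀ e p → proj₁ (edge e) ≢ middle p
  tail-not-middle e p with edgeView e
  ... | inj₁ (_ , _ , d) = left≢middle _ p ∘ trans (sym (cong proj₁ d))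
  ... | inj₂ (_ , _ , d) = right≢middle _ p ∘ trans (sym (cong proj₁ d))

  D : Digraph
  D = record
    { n = V ; m = E ; edge = edge ; edge-inj = edge-injective
    ; loopless = λ e → tail-not-middle e _ ∘ flip trans (proj₂ (head-middle e)) }

  open Digraph D using (M; rk; gD)

  no-2-path : ∀ e e′ → proj₂ (edge e) ≢ proj₁ (edge e′)
  no-2-path e e′ head≡tail = tail-not-middle e′ _ (trans (sym head≡tail) (proj₂ (head-middle e)))

  edge-fromLeft : ∀ p → edge (p ↑ˡ n * n) ≡ fromLeft p
  edge-fromLeft p = cong [ fromLeft , fromRight ]′ (splitAt-↑ˡ (n * n) p (n * n))

  edge-fromRight : ∀ p → edge (n * n ↑ʳ p) ≡ fromRight p
  edge-fromRight p = cong [ fromLeft , fromRight ]′ (splitAt-↑ʳ (n * n) (n * n) p)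

  row-combine : ∀ i j → row (combine i j) ≡ i
  row-combine i j = cong proj₁ (remQuot-combine {n} {n} i j)

  col-combine : ∀ i j → col (combine i j) ≡ j
  col-combine i j = cong proj₂ (remQuot-combine {n} {n} i j)

  M-left : ∀ i j → M (left i) (middle (combine i j)) ≡ true
  M-left i j = subst (λ uv → M (proj₁ uv) (proj₂ uv) ≡ true)
                     (trans (edge-fromLeft (combine i j))
                            (cong (λ i′ → left i′ , middle (combine i j)) (row-combine i j)))
                     (M-complete D (combine i j ↑ˡ n * n))

  M-right : ∀ i j → M (right j) (middle (combine i j)) ≡ true
  M-right i j = subst (λ uv → M (proj₁ uv) (proj₂ uv) ≡ true)
                      (trans (edge-fromRight (combine i j))
                             (cong (λ j′ → right j′ , middle (combine i j)) (col-combine i j)))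
                      (M-complete D (n * n ↑ʳ combine i j))

  M-left⁻¹ : ∀ {i p} → M (left i) (middle p) ≡ true → row p ≡ i
  M-left⁻¹ Mlm with M-sound D Mlm
  ... | e , tail≡ , head≡ with edgeView e
  ...   | inj₁ (p′ , _ , d) =
    trans (cong row (sym (middle-injective (trans (sym (cong proj₂ d)) head≡))))
          (left-injective (trans (sym (cong proj₁ d)) tail≡))
  ...   | inj₂ (_ , _ , d) = ⊥-elim (left≢right _ _ (sym (trans (sym (cong proj₁ d)) tail≡)))

  M-right⁻¹ : ∀ {j p} → M (right j) (middle p) ≡ true → col p ≡ j
  M-right⁻¹ Mrm with M-sound D Mrm
  ... | e , tail≡ , head≡ with edgeView e
  ...   | inj₂ (p′ , _ , d) =
    trans (cong col (sym (middle-injective (trans (sym (cong proj₂ d)) head≡))))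
          (right-injective (trans (sym (cong proj₁ d)) tail≡))
  ...   | inj₁ (_ , _ , d) = ⊥-elim (left≢right _ _ (trans (sym (cong proj₁ d)) tail≡))

  -- Pair up left vertices in Y with right vertices outside Y. The middle vertex of each pair
  -- lies on one side of the cut, and the end of the pair on the other side matches it across
  -- the cut; the middle vertices of the other pairs are not adjacent to that end.
  module Crossing (Y : Subset V) where
    inL outR : Fin n → Bool
    inL i = lookup Y (left i)
    outR j = not (lookup Y (right j))

    pairs : List (Fin n × Fin n)
    pairs = zip (support inL) (support outR)

    mid : Fin n × Fin n → Fin V
    mid (i , j) = middle (combine i j)

    mid∈Y? : Decidable (λ π → lookup Y (mid π) ≡ true)
    mid∈Y? π = lookup Y (mid π) ≟ᵇ true

    into outOf : List (Fin n × Fin n)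
    into = filter mid∈Y? pairs
    outOf = filter (∁? mid∈Y?) pairs

    viaRight viaLeft : Fin n × Fin n → Fin V × Fin V
    viaRight π = right (proj₂ π) , mid π
    viaLeft π = left (proj₁ π) , mid π

    all-map : ∀ {P : Fin V × Fin V → Set} (f : Fin n × Fin n → Fin V × Fin V) xs →
              (∀ {π} → π ∈ xs → P (f π)) → All P (map f xs)
    all-map f xs Pf = Allₚ.map⁺ (All.tabulate Pf)

    right-distinct : AllPairs (λ π π′ → right (proj₂ π) ≢ right (proj₂ π′)) pairs
    right-distinct =
      AllPairs.map (λ j≢j′ → j≢j′ ∘ right-injective) (zip-AllPairs₂ {xs = support inL} (support-unique outR))

    left-distinct : AllPairs (λ π π′ → left (proj₁ π) ≢ left (proj₁ π′)) pairs
    left-distinct =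
      AllPairs.map (λ i≢i′ → i≢i′ ∘ left-injective) (zip-AllPairs₁ {ys = support outR} (support-unique inL))

    ∈-into⁻ : ∀ {π} → π ∈ into → outR (proj₂ π) ≡ true × lookup Y (mid π) ≡ true
    ∈-into⁻ π∈ with ∈-filter⁻ mid∈Y? {xs = pairs} π∈
    ... | π∈pairs , mid∈Y = ∈-support⁻ outR (proj₂ (∈-zip⁻ {xs = support inL} π∈pairs)) , mid∈Y

    ∈-outOf⁻ : ∀ {π} → π ∈ outOf → inL (proj₁ π) ≡ true × lookup Y (mid π) ≡ false
    ∈-outOf⁻ π∈ with ∈-filter⁻ (∁? mid∈Y?) {xs = pairs} π∈
    ... | π∈pairs , mid∉Y = ∈-support⁻ inL (proj₁ (∈-zip⁻ {ys = support outR} π∈pairs)) , ¬-not mid∉Y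

    into-matching : IsInducedMatching D (∁ Y) Y (map viaRight into)
    into-matching = record
      { rows-distinct = AllPairsₚ.map⁺ (AllPairsₚ.filter⁺ mid∈Y? right-distinct)
      ; rows-in = all-map viaRight into λ π∈ → trans (lookup-∁ Y _) (proj₁ (∈-into⁻ π∈))
      ; cols-in = all-map viaRight into λ π∈ → proj₂ (∈-into⁻ π∈)
      ; matched = all-map viaRight into λ {π} _ → M-right (proj₁ π) (proj₂ π)
      ; induced = induced }
      where
      induced : ∀ {π π′} → π ∈ map viaRight into → π′ ∈ map viaRight into →
                M (proj₁ π) (proj₂ π′) ≡ true → proj₁ π ≡ proj₁ π′
      induced π∈ π′∈ M-cross with ∈-map⁻ viaRight π∈ | ∈-map⁻ viaRight π′∈
      ... | (i , j) , _ , refl | (i′ , j′) , _ , refl =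
        cong right (trans (sym (M-right⁻¹ M-cross)) (col-combine i′ j′))

    outOf-matching : IsInducedMatching D Y (∁ Y) (map viaLeft outOf)
    outOf-matching = record
      { rows-distinct = AllPairsₚ.map⁺ (AllPairsₚ.filter⁺ (∁? mid∈Y?) left-distinct)
      ; rows-in = all-map viaLeft outOf λ π∈ → proj₁ (∈-outOf⁻ π∈)
      ; cols-in = all-map viaLeft outOf λ π∈ → trans (lookup-∁ Y _) (cong not (proj₂ (∈-outOf⁻ π∈)))
      ; matched = all-map viaLeft outOf λ {π} _ → M-left (proj₁ π) (proj₂ π)
      ; induced = induced }
      where
      induced : ∀ {π π′} → π ∈ map viaLeft outOf → π′ ∈ map viaLeft outOf →
                M (proj₁ π) (proj₂ π′) ≡ true → proj₁ π ≡ proj₁ π′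
      induced π∈ π′∈ M-cross with ∈-map⁻ viaLeft π∈ | ∈-map⁻ viaLeft π′∈
      ... | (i , j) , _ , refl | (i′ , j′) , _ , refl =
        cong left (trans (sym (M-left⁻¹ M-cross)) (row-combine i′ j′))

    pairs-≤-gD : length pairs ≤ gD Y
    pairs-≤-gD = begin
      length pairs                                              ≡⟨ sym (length-filter+filter-∁ mid∈Y? pairs) ⟩
      length into + length outOf                                ≡⟨ sym (cong₂ _+_ (length-map viaRight into)
                                                                                  (length-map viaLeft outOf)) ⟩
      length (map viaRight into) + length (map viaLeft outOf)   ≤⟨ +-mono-≤ (rk-≥-inducedMatching D into-matching)
                                                                            (rk-≥-inducedMatching D outOf-matching) ⟩
      gD Y                                                      ∎
      where open ≤-Reasoning

    pairs-≡-⊓ : length pairs ≡ countF inL ⊓ countF outR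
    pairs-≡-⊓ = trans (length-zipWith _,_ (support inL) (support outR))
                      (cong₂ _⊓_ (length-support inL) (length-support outR))

  ⊓-≤-gD : ∀ Y → countF (λ i → lookup Y (left i)) ⊓ countF (λ j → not (lookup Y (right j))) ≤ gD Y
  ⊓-≤-gD Y = subst (_≤ gD Y) pairs-≡-⊓ pairs-≤-gD
    where open Crossing Y

  gD-∁ : ∀ Y → gD (∁ Y) ≡ gD Y
  gD-∁ Y rewrite ∁-involutive Y = +-comm (rk Y (∁ Y)) (rk (∁ Y) Y)

  -- Both the cut and its complement cross-match left against right vertices, and one of them
  -- has more than s right vertices on the far side.
  separation-≤-gD : ∀ s → suc s + s ≤ n → ∀ Y → Separates s left Y → suc s ≤ gD Y
  separation-≤-gD s 2s+1≤n Y (left-in , left-out) with suc s ≤? countF (λ j → not (lookup Y (right j)))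
  ... | yes right-out = ≤-trans (⊓-glb left-in right-out) (⊓-≤-gD Y)
  ... | no right-out≤s = subst (suc s ≤_) (gD-∁ Y) (≤-trans (⊓-glb left-in′ right-in′) (⊓-≤-gD (∁ Y)))
    where
    right-in : suc s ≤ countF (λ j → lookup Y (right j))
    right-in = +-cancelʳ-≤ s _ _ (begin
      suc s + s
        ≤⟨ 2s+1≤n ⟩
      n
        ≡⟨ sym (countF-+-not (λ j → lookup Y (right j))) ⟩
      countF (λ j → lookup Y (right j)) + countF (λ j → not (lookup Y (right j)))
        ≤⟨ +-monoʳ-≤ _ (≤-pred (≰⇒> right-out≤s)) ⟩
      countF (λ j → lookup Y (right j)) + s ∎)
      where open ≤-Reasoning
    left-in′ : suc s ≤ countF (λ i → lookup (∁ Y) (left i))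
    left-in′ = subst (suc s ≤_) (countF-cong (λ i → sym (lookup-∁ Y (left i)))) left-out
    right-in′ : suc s ≤ countF (λ j → not (lookup (∁ Y) (right j)))
    right-in′ = subst (suc s ≤_)
      (countF-cong (λ j → sym (trans (cong not (lookup-∁ Y (right j))) (not-involutive _)))) right-in

Least : (ℕ → Set) → Set
Least P = Σ ℕ λ b → P b × (∀ {j} → j < b → ¬ P j)

¬¬-least : ∀ {P : ℕ → Set} w → P w → ¬ ¬ Least P
¬¬-least {P} = <-rec (λ w → P w → ¬ ¬ Least P) λ w smaller Pw no-least →
  no-least (w , Pw , λ j<w Pj → smaller j<w Pj no-least)

¬¬-layoutWidth : ∀ {m} (f : Subset m → ℕ) → Layout m → ¬ ¬ Σ ℕ (IsLayoutWidth f)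
¬¬-layoutWidth {m} f L = ¬¬-map least⇒width (¬¬-least (maxList (map f (allSubsets m))) (L , bounded))
  where
  bounded : WidthAtMost f L (maxList (map f (allSubsets m)))
  bounded _ _ _ Y _ = maxList-upper _ (∈-map⁺ f (allSubsets-complete Y))
  least⇒width : Least (λ j → Σ (Layout m) λ L′ → WidthAtMost f L′ j) → Σ ℕ (IsLayoutWidth f)
  least⇒width (b , width-b , below-b) = b , width-b , λ L′ j width-j → ≮⇒≥ λ j<b → below-b j<b (L′ , width-j)

layout : ∀ m → 2 ≤ m → Layout m
layout (suc (suc m′)) _ = Caterpillar.layout m′
layout (suc zero) (s≤s ())

mainTheorem7 : ¬ (Σ (ℕ → ℕ) λ g →
                    (D : Digraph) (k b : ℕ) → IsDbw D k → IsBcrk D b → b ≤ g k)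
mainTheorem7 (g , bcrk≤g[dbw]) =
  ¬¬-layoutWidth (Digraph.gD D) (layout V 2≤V) λ (b , bcrk=b@((L , width-b) , _)) →
  let b≤s = bcrk≤g[dbw] D 0 b (dbw≡0 D no-2-path (layout E 2≤E)) bcrk=b in
  ¬¬-width-≥-separation L left left-injective s ≤-refl (Digraph.gD D) (separation-≤-gD s 2s+1≤n) width-b
    λ s<b → <⇒≱ s<b b≤s
  where
  s = g 0
  open SubdividedBiclique (3 * suc s)
  2≤n : 2 ≤ 3 * suc s
  2≤n = ≤-trans (m≤m+n 2 s) (2+s≤3[1+s] s)
  2≤V : 2 ≤ V
  2≤V = ≤-trans 2≤n (m≤m+n _ _)
  2≤E : 2 ≤ E
  2≤E = ≤-trans 2≤n (≤-trans (m≤m*n (3 * suc s) (3 * suc s)) (m≤m+n _ _))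
  2s+1≤n : suc s + s ≤ 3 * suc s
  2s+1≤n = +-monoʳ-≤ (suc s) (≤-trans (n≤1+n s) (m≤m+n (suc s) _))
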